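{- Let $\varepsilon>0$, let $L\ge 0$ be an integer, and for each level $j\in\{0,1,\dots,L\}$ let $P_j$ be a finite set and $D_j\subseteq P_j$. If $\sum_{j=0}^{L}|D_j|\ge\varepsilon\sum_{j=0}^{L}|P_j|$, then there exists a level $\ell\in\{0,\dots,L\}$ such that for every level $i\le\ell$, $\sum_{j=i}^{\ell}|D_j|\ge\varepsilon\sum_{j=i}^{\ell}|P_j|$.
   Formalization: The parameter ε ranges over the positive rationals. -}

module Defs where

open import Data.Nat using (ℕ; zero; suc; _+_; _∸_)
open import Data.Integer using (+_)
open import Data.Rational using (ℚ; _/_; _*_; _≤_)

sumFrom : (ℕ → ℕ) → ℕ → ℕ → ℕ
sumFrom f i zero    = 0
sumFrom f i (suc c) = f i + sumFrom f (suc i) c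

-- Σ_{j=i}^{ℓ} f j  (empty sum if ℓ < i)
Σ[_⋯_]_ : ℕ → ℕ → (ℕ → ℕ) → ℕ
Σ[ i ⋯ ℓ ] f = sumFrom f i (suc ℓ ∸ i)

toℚ : ℕ → ℚ
toℚ n = + n / 1

AtLeast : ℚ → ℕ → ℕ → Set
AtLeast ε d p = ε * toℚ p ≤ toℚ d

-- Let x_j = |D_j| - ε|P_j| and let g k = x_0 + ⋯ + x_{k-1} be the prefix sums of the excess.
-- Choose ℓ ≤ L with g (ℓ+1) maximal among g 1, …, g (L+1). The hypothesis says g (L+1) ≥ 0 = g 0,
-- so g (ℓ+1) ≥ g i for every i ≤ ℓ, i.e. x_i + ⋯ + x_ℓ = g (ℓ+1) - g i ≥ 0.
module Submission where

open import Defs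
open import Data.Nat using (ℕ; _≤_)
open import Data.Fin.Subset using (Subset; ∣_∣)
open import Data.Product using (Σ; _×_)
open import Data.Rational using (ℚ; 0ℚ; _<_)

open import Level using (Level)
open import Data.Nat as ℕ using (zero; suc; _∸_)
import Data.Nat.Properties as ℕ
import Data.Integer.Properties as ℤ
open import Data.Integer as ℤ using (+_)
open import Data.Rational as ℚ using (_+_; _-_; _*_; -_; fromℚᵘ; toℚᵘ)
open import Data.Rational.Properties as ℚ using (fromℚᵘ-cong; fromℚᵘ-toℚᵘ; toℚᵘ-fromℚᵘ; toℚᵘ-homo-+)
open import Data.Rational.Unnormalised as ℚᵘ using (mkℚᵘ; *≡*)
import Data.Rational.Unnormalised.Properties as ℚᵘ
open import Data.Rational.Solver using (module +-*-Solver)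
open import Data.Product using (∃-syntax; _,_)
open import Data.Sum using (inj₁; inj₂)
open import Relation.Binary.Bundles using (TotalPreorder)
open import Relation.Binary.PropositionalEquality
open +-*-Solver

private
  variable
    c ℓ₁ ℓ₂ : Level

module _ (P : TotalPreorder c ℓ₁ ℓ₂) where
  open TotalPreorder P renaming (refl to ≲-refl; trans to ≲-trans)

  argmax-upTo : (h : ℕ → Carrier) (L : ℕ) →
                ∃[ m ] m ≤ L × (∀ {k} → k ≤ L → h k ≲ h m)
  argmax-upTo h zero = 0 , ℕ.z≤n , λ { ℕ.z≤n → ≲-refl }
  argmax-upTo h (suc L) with argmax-upTo h L
  ... | m , m≤L , maximal with total (h m) (h (suc L))
  ... | inj₁ hm≲hL+1 = suc L , ℕ.≤-refl , below
    where
    below : ∀ {k} → k ≤ suc L → h k ≲ h (suc L)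
    below k≤L+1 with ℕ.m≤n⇒m<n∨m≡n k≤L+1
    ... | inj₁ k<L+1 = ≲-trans (maximal (ℕ.≤-pred k<L+1)) hm≲hL+1
    ... | inj₂ refl = ≲-refl
  ... | inj₂ hL+1≲hm = m , ℕ.m≤n⇒m≤1+n m≤L , below
    where
    below : ∀ {k} → k ≤ suc L → h k ≲ h m
    below k≤L+1 with ℕ.m≤n⇒m<n∨m≡n k≤L+1
    ... | inj₁ k<L+1 = maximal (ℕ.≤-pred k<L+1)
    ... | inj₂ refl = hL+1≲hm

  peak-dominates-prefix : (g : ℕ → Carrier) (L : ℕ) → g 0 ≲ g (suc L) →
                          ∃[ m ] m ≤ L × (∀ {i} → i ≤ m → g i ≲ g (suc m))
  peak-dominates-prefix g L g0≲gL+1 with argmax-upTo (λ k → g (suc k)) L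
  ... | m , m≤L , maximal = m , m≤L , dominates
    where
    dominates : ∀ {i} → i ≤ m → g i ≲ g (suc m)
    dominates {zero}  _   = ≲-trans g0≲gL+1 (maximal ℕ.≤-refl)
    dominates {suc k} k<m = maximal (ℕ.≤-trans (ℕ.<⇒≤ k<m) m≤L)

sumFrom-+ : ∀ f i a b → sumFrom f i (a ℕ.+ b) ≡ sumFrom f i a ℕ.+ sumFrom f (i ℕ.+ a) b
sumFrom-+ f i zero    b = cong (λ j → sumFrom f j b) (sym (ℕ.+-identityʳ i))
sumFrom-+ f i (suc a) b rewrite sumFrom-+ f (suc i) a b | ℕ.+-suc i a =
  sym (ℕ.+-assoc (f i) (sumFrom f (suc i) a) _)

prefix-split : ∀ f {i ℓ} → i ≤ suc ℓ →
               sumFrom f 0 (suc ℓ) ≡ sumFrom f 0 i ℕ.+ Σ[ i ⋯ ℓ ] f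
prefix-split f {i} {ℓ} i≤ℓ+1 = begin
  sumFrom f 0 (suc ℓ)                            ≡⟨ cong (sumFrom f 0) (ℕ.m+[n∸m]≡n i≤ℓ+1) ⟨
  sumFrom f 0 (i ℕ.+ (suc ℓ ∸ i))                ≡⟨ sumFrom-+ f 0 i (suc ℓ ∸ i) ⟩
  sumFrom f 0 i ℕ.+ Σ[ i ⋯ ℓ ] f                 ∎
  where open ≡-Reasoning

toℚ-+ : ∀ a b → toℚ (a ℕ.+ b) ≡ toℚ a + toℚ b
toℚ-+ a b = trans (fromℚᵘ-cong homoᵘ) (fromℚᵘ-toℚᵘ (toℚ a + toℚ b))
  where
  open ℚᵘ.≃-Reasoning
  homoᵘ : mkℚᵘ (+ (a ℕ.+ b)) 0 ℚᵘ.≃ toℚᵘ (toℚ a + toℚ b)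
  homoᵘ = begin
    mkℚᵘ (+ (a ℕ.+ b)) 0                     ≈⟨ *≡* (cong (ℤ._* + 1) numerator) ⟩
    mkℚᵘ (+ a) 0 ℚᵘ.+ mkℚᵘ (+ b) 0           ≈⟨ ℚᵘ.+-cong (toℚᵘ-fromℚᵘ (mkℚᵘ (+ a) 0))
                                                             (toℚᵘ-fromℚᵘ (mkℚᵘ (+ b) 0)) ⟨
    toℚᵘ (toℚ a) ℚᵘ.+ toℚᵘ (toℚ b)           ≈⟨ toℚᵘ-homo-+ (toℚ a) (toℚ b) ⟨
    toℚᵘ (toℚ a + toℚ b)                     ∎
    where
    numerator : + (a ℕ.+ b) ≡ + a ℤ.* + 1 ℤ.+ + b ℤ.* + 1
    numerator = trans (ℤ.pos-+ a b) (sym (cong₂ ℤ._+_ (ℤ.*-identityʳ (+ a)) (ℤ.*-identityʳ (+ b))))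

p≤q⇒0≤q-p : ∀ {p q} → p ℚ.≤ q → 0ℚ ℚ.≤ q - p
p≤q⇒0≤q-p {p} {q} p≤q = subst (ℚ._≤ q - p) (ℚ.+-inverseʳ p) (ℚ.+-monoˡ-≤ (- p) p≤q)

0≤q-p⇒p≤q : ∀ {p q} → 0ℚ ℚ.≤ q - p → p ℚ.≤ q
0≤q-p⇒p≤q {p} {q} 0≤q-p = subst₂ ℚ._≤_ (ℚ.+-identityˡ p) q-p+p≡q (ℚ.+-monoˡ-≤ p 0≤q-p)
  where
  q-p+p≡q : q - p + p ≡ q
  q-p+p≡q = solve 2 (λ p q → q :- p :+ p := q) refl p q

excess : ℚ → ℕ → ℕ → ℚ
excess ε d p = toℚ d - ε * toℚ p

excess-zero : ∀ ε → excess ε 0 0 ≡ 0ℚ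
excess-zero ε = cong (λ x → 0ℚ - x) (ℚ.*-zeroʳ ε)

excess-+ : ∀ ε d d′ p p′ → excess ε (d ℕ.+ d′) (p ℕ.+ p′) ≡ excess ε d p + excess ε d′ p′
excess-+ ε d d′ p p′ rewrite toℚ-+ d d′ | toℚ-+ p p′ =
  solve 5 (λ ε d d′ p p′ → d :+ d′ :- ε :* (p :+ p′) := (d :- ε :* p) :+ (d′ :- ε :* p′))
        refl ε (toℚ d) (toℚ d′) (toℚ p) (toℚ p′)

prefixExcess : ℚ → (ℕ → ℕ) → (ℕ → ℕ) → ℕ → ℚ
prefixExcess ε d p k = excess ε (sumFrom d 0 k) (sumFrom p 0 k)

prefixExcess-split : ∀ ε d p {i ℓ} → i ≤ suc ℓ →
                     prefixExcess ε d p (suc ℓ)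
                     ≡ prefixExcess ε d p i + excess ε (Σ[ i ⋯ ℓ ] d) (Σ[ i ⋯ ℓ ] p)
prefixExcess-split ε d p {i} {ℓ} i≤ℓ+1
  rewrite prefix-split d i≤ℓ+1 | prefix-split p i≤ℓ+1 =
  excess-+ ε (sumFrom d 0 i) (Σ[ i ⋯ ℓ ] d) (sumFrom p 0 i) (Σ[ i ⋯ ℓ ] p)

prefixExcess-≤⇒AtLeast : ∀ ε d p {i ℓ} → i ≤ suc ℓ →
                         prefixExcess ε d p i ℚ.≤ prefixExcess ε d p (suc ℓ) →
                         AtLeast ε (Σ[ i ⋯ ℓ ] d) (Σ[ i ⋯ ℓ ] p)
prefixExcess-≤⇒AtLeast ε d p {i} {ℓ} i≤ℓ+1 gi≤gℓ+1 =
  0≤q-p⇒p≤q (subst (0ℚ ℚ.≤_) difference (p≤q⇒0≤q-p gi≤gℓ+1))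
  where
  difference : prefixExcess ε d p (suc ℓ) - prefixExcess ε d p i
             ≡ excess ε (Σ[ i ⋯ ℓ ] d) (Σ[ i ⋯ ℓ ] p)
  difference rewrite prefixExcess-split ε d p i≤ℓ+1 =
    solve 2 (λ g x → g :+ x :- g := x) refl
            (prefixExcess ε d p i) (excess ε (Σ[ i ⋯ ℓ ] d) (Σ[ i ⋯ ℓ ] p))

lemma1 : (ε : ℚ) → 0ℚ < ε → (L : ℕ) → (n : ℕ → ℕ) → (D : (j : ℕ) → Subset (n j)) →
    AtLeast ε (Σ[ 0 ⋯ L ] (λ j → ∣ D j ∣)) (Σ[ 0 ⋯ L ] n) →
    Σ ℕ (λ ℓ → (ℓ ≤ L) × ((i : ℕ) → i ≤ ℓ →
    AtLeast ε (Σ[ i ⋯ ℓ ] (λ j → ∣ D j ∣)) (Σ[ i ⋯ ℓ ] n)))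
lemma1 ε _ L n D total≥ =
  let ℓ , ℓ≤L , dominates = peak-dominates-prefix ℚ.≤-totalPreorder (prefixExcess ε d n) L start≤end
  in ℓ , ℓ≤L , λ i i≤ℓ → prefixExcess-≤⇒AtLeast ε d n (ℕ.m≤n⇒m≤1+n i≤ℓ) (dominates i≤ℓ)
  where
  d : ℕ → ℕ
  d j = ∣ D j ∣
  start≤end : prefixExcess ε d n 0 ℚ.≤ prefixExcess ε d n (suc L)
  start≤end = subst (ℚ._≤ prefixExcess ε d n (suc L)) (sym (excess-zero ε)) (p≤q⇒0≤q-p total≥)
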